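{- Let $T$ be a semigraceful tree of order $2n+1$. Then the complete multigraph $K_{2n+1}^{(2)}$ (on $2n+1$ vertices, every pair of distinct vertices joined by exactly $2$ edges) can be decomposed into $2n+1$ copies of $T$; that is, its edge multiset can be partitioned into $2n+1$ subgraphs each isomorphic to $T$. Moreover the decomposition can be taken cyclic: identifying the vertices with $\mathbb{Z}_{2n+1}$, the copies are the images of a single copy under the $2n+1$ rotations $x\mapsto x+k$.
   Context: For natural numbers $m,s,t$ define $dc_{m}(s,t)=|s-t|$ if $|s-t|\le m/2$ and $dc_m(s,t)=m-|s-t|$ if $|s-t|\ge m/2$. A tree $T$ of order $2n+1$ is \emph{semigraceful} if its vertices can be labeled bijectively with the numbers $1,\dots,2n+1$ (label $\ell$) so that the multiset of induced edge labels $dc_{2n+1}(\ell(u),\ell(v))$, over the edges $uv$ of $T$, equals $\{1,1,2,2,\dots,n,n\}$. -}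

module Defs where

open import Data.Nat using (ℕ; zero; suc; _+_; _*_; _∸_; _≤ᵇ_; _<ᵇ_; _⊔_; _⊓_; _%_; ∣_-_∣; NonZero)
open import Data.Bool using (if_then_else_)
open import Data.Fin using (Fin; toℕ)
open import Data.List using (List; []; _∷_; length; map; concatMap; upTo)
open import Data.Product using (_×_; _,_; Σ)
open import Data.List.Membership.Propositional using (_∈_)
open import Data.List.Relation.Binary.Permutation.Propositional using (_↭_)
open import Data.Sum using (_⊎_)
open import Relation.Binary.PropositionalEquality using (_≡_)
open import Function.Definitions using (Bijective; Injective)

dc : ℕ → ℕ → ℕ → ℕ
dc m s t = if (2 * ∣ s - t ∣) ≤ᵇ m then ∣ s - t ∣ else m ∸ ∣ s - t ∣

Edges : ℕ → Set
Edges N = List (Fin N × Fin N)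

data Reach {N : ℕ} (E : Edges N) (u : Fin N) : Fin N → Set where
  here : Reach E u u
  step : ∀ {w v} → Reach E u w → ((w , v) ∈ E ⊎ (v , w) ∈ E) → Reach E u v

IsTree : (N : ℕ) → Edges N → Set
IsTree N E = (length E ≡ N ∸ 1) × (∀ u v → Reach E u v)

doubled : ℕ → List ℕ
doubled n = concatMap (λ i → suc i ∷ suc i ∷ []) (upTo n)

-- Semigraceful: bijective labelling with 1..2n+1 (label of v is 1 + toℕ (ℓ v))
Semigraceful : (n : ℕ) → Edges (suc (2 * n)) → Set
Semigraceful n E =
  Σ (Fin (suc (2 * n)) → Fin (suc (2 * n))) λ ℓ →
    Bijective _≡_ _≡_ ℓ ×
    (map (λ e → dc (suc (2 * n)) (suc (toℕ (ℓ (Data.Product.proj₁ e))))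
                               (suc (toℕ (ℓ (Data.Product.proj₂ e))))) E
      ↭ doubled n)

-- unordered edge normalised as (min , max)
uedge : ℕ → ℕ → ℕ × ℕ
uedge a b = (a ⊓ b , a ⊔ b)

K2 : ℕ → List (ℕ × ℕ)
K2 N = concatMap (λ a → concatMap (λ b →
         if a <ᵇ b then (a , b) ∷ (a , b) ∷ [] else []) (upTo N)) (upTo N)

copyEdges : {N : ℕ} → Edges N → (Fin N → ℕ) → List (ℕ × ℕ)
copyEdges E g = map (λ e → uedge (g (Data.Product.proj₁ e)) (g (Data.Product.proj₂ e))) E

rot : {N : ℕ} → .{{NonZero N}} → ℕ → (Fin N → Fin N) → Fin N → ℕ
rot {N} k f0 x = (toℕ (f0 x) + k) % N

cyclicUnion : {N : ℕ} → .{{NonZero N}} → Edges N → (Fin N → Fin N) → List (ℕ × ℕ)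
cyclicUnion {N} E f0 = concatMap (λ k → copyEdges E (rot k f0)) (upTo N)

module Submission where

-- Compare multiplicities of unordered pairs {i, j}, i < j < N = 2n + 1.  Writing
-- δ a b for b − a in ℤ_N, the N rotations of an edge {a, b} hit {i, j} once for
-- each sign with δ a b = ±(j − i); since N is odd the two signs are exclusive, so
-- {i, j} is hit exactly once if dc(a, b) = dc(i, j) and never otherwise.  Summing
-- over the edges, the cyclic union contains {i, j} as often as the tree has edges
-- of label dc(i, j), which is twice because the labels are 1, 1, …, n, n; and
-- twice is the multiplicity of {i, j} in K_N^(2).

open import Algebra.Properties.CommutativeSemigroup using (interchange; x∙yz≈y∙xz)
open import Data.Bool using (true; false; if_then_else_)
open import Data.Fin using (Fin; toℕ)
open import Data.Fin.Properties using (toℕ<n)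
open import Data.List using (List; []; _∷_; _++_; map; concatMap; upTo)
open import Data.List.Membership.Propositional using (_∈_)
open import Data.List.Membership.Propositional.Properties using (∈-map⁺; ∈-∃++; ∈-upTo⁻; ∈-concatMap⁻)
open import Data.List.Properties using (map-++; map-∘; map-applyUpTo; map-upTo)
open import Data.List.Relation.Unary.Any using (here; there; satisfied)
open import Data.List.Relation.Binary.Permutation.Propositional using (_↭_; ↭-refl; ↭-sym; ↭-trans; ↭-prep)
open import Data.List.Relation.Binary.Permutation.Propositional.Properties using (map⁺; shift; ∈-resp-↭)
open import Data.Nat
open import Data.Nat.DivMod
open import Data.Nat.ListAction using (sum)
open import Data.Nat.ListAction.Properties using (sum-++; sum-↭)
open import Data.Nat.Properties
open import Data.Product using (_×_; _,_; Σ; proj₁; proj₂; uncurry)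
open import Data.Product.Properties using (≡-dec)
open import Data.Sum as Sum using (_⊎_; inj₁; inj₂)
open import Function using (_∘_)
open import Function.Bundles using (_⇔_; mk⇔; Equivalence)
open import Function.Definitions using (Injective)
open import Relation.Binary.Definitions using (DecidableEquality; tri<; tri≈; tri>)
open import Relation.Binary.PropositionalEquality
open import Relation.Nullary using (Dec; yes; no; ¬_; does; contradiction; ofʸ; ofⁿ)
open import Relation.Nullary.Decidable using (_×-dec_; _⊎-dec_)

open import Defs

open ≡-Reasoning

private
  variable
    A B P Q : Set

𝟙 : Dec P → ℕ
𝟙 P? = if does P? then 1 else 0

𝟙-yes : P → (P? : Dec P) → 𝟙 P? ≡ 1
𝟙-yes p (yes _) = refl
𝟙-yes p (no ¬p) = contradiction p ¬p

𝟙-no : ¬ P → (P? : Dec P) → 𝟙 P? ≡ 0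
𝟙-no ¬p (yes p) = contradiction p ¬p
𝟙-no ¬p (no _)  = refl

𝟙-cong : P ⇔ Q → (P? : Dec P) (Q? : Dec Q) → 𝟙 P? ≡ 𝟙 Q?
𝟙-cong P⇔Q (yes p) Q? = sym (𝟙-yes (Equivalence.to P⇔Q p) Q?)
𝟙-cong P⇔Q (no ¬p) Q? = sym (𝟙-no (¬p ∘ Equivalence.from P⇔Q) Q?)

𝟙-× : (P? : Dec P) (Q? : Dec Q) → 𝟙 (P? ×-dec Q?) ≡ 𝟙 P? * 𝟙 Q?
𝟙-× (yes _) (yes _) = refl
𝟙-× (yes _) (no _)  = refl
𝟙-× (no _)  _       = refl

𝟙-⊎ : ¬ (P × Q) → (P? : Dec P) (Q? : Dec Q) → 𝟙 (P? ⊎-dec Q?) ≡ 𝟙 P? + 𝟙 Q?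
𝟙-⊎ ¬p×q (yes p) (yes q) = contradiction (p , q) ¬p×q
𝟙-⊎ ¬p×q (yes _) (no _)  = refl
𝟙-⊎ ¬p×q (no _)  (yes _) = refl
𝟙-⊎ ¬p×q (no _)  (no _)  = refl

∑ : List A → (A → ℕ) → ℕ
∑ xs f = sum (map f xs)

syntax ∑ xs (λ x → e) = ∑[ x ∈ xs ] e

∑-cong : {f g : A → ℕ} (xs : List A) → (∀ x → x ∈ xs → f x ≡ g x) → ∑ xs f ≡ ∑ xs g
∑-cong []       f≗g = refl
∑-cong (x ∷ xs) f≗g = cong₂ _+_ (f≗g x (here refl)) (∑-cong xs (λ y → f≗g y ∘ there))

∑-zero : {f : A → ℕ} (xs : List A) → (∀ x → x ∈ xs → f x ≡ 0) → ∑ xs f ≡ 0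
∑-zero []       f≗0 = refl
∑-zero (x ∷ xs) f≗0 = cong₂ _+_ (f≗0 x (here refl)) (∑-zero xs (λ y → f≗0 y ∘ there))

∑-++ : (f : A → ℕ) (xs ys : List A) → ∑ (xs ++ ys) f ≡ ∑ xs f + ∑ ys f
∑-++ f xs ys = trans (cong sum (map-++ f xs ys)) (sum-++ (map f xs) (map f ys))

∑-↭ : (f : A → ℕ) {xs ys : List A} → xs ↭ ys → ∑ xs f ≡ ∑ ys f
∑-↭ f xs↭ys = sum-↭ (map⁺ f xs↭ys)

∑-+ : (f g : A → ℕ) (xs : List A) → ∑[ x ∈ xs ] (f x + g x) ≡ ∑ xs f + ∑ xs g
∑-+ f g []       = refl
∑-+ f g (x ∷ xs) = trans (cong (f x + g x +_) (∑-+ f g xs))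
                         (interchange +-commutativeSemigroup (f x) (g x) (∑ xs f) (∑ xs g))

∑-map : (g : B → ℕ) (f : A → B) (xs : List A) → ∑ (map f xs) g ≡ ∑[ x ∈ xs ] g (f x)
∑-map g f xs = cong sum (sym (map-∘ xs))

∑-concatMap : (g : B → ℕ) (f : A → List B) (xs : List A) →
              ∑ (concatMap f xs) g ≡ ∑[ x ∈ xs ] ∑ (f x) g
∑-concatMap g f []       = refl
∑-concatMap g f (x ∷ xs) = trans (∑-++ g (f x) (concatMap f xs)) (cong (∑ (f x) g +_) (∑-concatMap g f xs))

∑-swap : (F : A → B → ℕ) (xs : List A) (ys : List B) →
         ∑[ x ∈ xs ] ∑[ y ∈ ys ] F x y ≡ ∑[ y ∈ ys ] ∑[ x ∈ xs ] F x y
∑-swap F []       ys = sym (∑-zero ys (λ _ _ → refl))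
∑-swap F (x ∷ xs) ys = begin
  ∑ ys (F x) + ∑[ x′ ∈ xs ] ∑ ys (F x′)          ≡⟨ cong (∑ ys (F x) +_) (∑-swap F xs ys) ⟩
  ∑ ys (F x) + ∑[ y ∈ ys ] ∑[ x′ ∈ xs ] F x′ y   ≡⟨ ∑-+ (F x) (λ y → ∑[ x′ ∈ xs ] F x′ y) ys ⟨
  ∑[ y ∈ ys ] (F x y + ∑[ x′ ∈ xs ] F x′ y)      ∎

∑-upTo-suc : (h : ℕ → ℕ) (N : ℕ) → ∑[ k ∈ upTo (suc N) ] h k ≡ h 0 + ∑[ k ∈ upTo N ] h (suc k)
∑-upTo-suc h N = cong (λ hs → h 0 + sum hs) (trans (map-applyUpTo suc h N) (sym (map-upTo (h ∘ suc) N)))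

∑-upTo-+ : (h : ℕ → ℕ) (m n : ℕ) →
           ∑[ k ∈ upTo (m + n) ] h k ≡ ∑[ k ∈ upTo m ] h k + ∑[ k ∈ upTo n ] h (m + k)
∑-upTo-+ h zero    n = refl
∑-upTo-+ h (suc m) n = begin
  ∑[ k ∈ upTo (suc m + n) ] h k                                      ≡⟨ ∑-upTo-suc h (m + n) ⟩
  h 0 + ∑[ k ∈ upTo (m + n) ] h (suc k)                              ≡⟨ cong (h 0 +_) (∑-upTo-+ (h ∘ suc) m n) ⟩
  h 0 + (∑[ k ∈ upTo m ] h (suc k) + ∑[ k ∈ upTo n ] h (suc m + k))  ≡⟨ +-assoc (h 0) _ _ ⟨
  h 0 + ∑[ k ∈ upTo m ] h (suc k) + ∑[ k ∈ upTo n ] h (suc m + k)    ≡⟨ cong (_+ ∑[ k ∈ upTo n ] h (suc m + k))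
                                                                              (∑-upTo-suc h m) ⟨
  ∑[ k ∈ upTo (suc m) ] h k + ∑[ k ∈ upTo n ] h (suc m + k)          ∎

∑-upTo-cong : {f g : ℕ → ℕ} (N : ℕ) → (∀ k → k < N → f k ≡ g k) → ∑ (upTo N) f ≡ ∑ (upTo N) g
∑-upTo-cong N f≗g = ∑-cong (upTo N) (λ k → f≗g k ∘ ∈-upTo⁻)

∑-upTo-single : {h : ℕ → ℕ} (N c : ℕ) → c < N → (∀ k → k < N → k ≢ c → h k ≡ 0) →
                ∑ (upTo N) h ≡ h c
∑-upTo-single {h} (suc N) zero _ h≗0 = begin
  ∑ (upTo (suc N)) h                ≡⟨ ∑-upTo-suc h N ⟩
  h 0 + ∑[ k ∈ upTo N ] h (suc k)   ≡⟨ cong (h 0 +_) (∑-zero (upTo N) λ k k∈ → h≗0 (suc k) (s<s (∈-upTo⁻ k∈)) λ ()) ⟩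
  h 0 + 0                           ≡⟨ +-identityʳ (h 0) ⟩
  h 0                               ∎
∑-upTo-single {h} (suc N) (suc c) (s<s c<N) h≗0 = begin
  ∑ (upTo (suc N)) h                ≡⟨ ∑-upTo-suc h N ⟩
  h 0 + ∑[ k ∈ upTo N ] h (suc k)   ≡⟨ cong₂ _+_ (h≗0 0 z<s λ ())
                                                  (∑-upTo-single N c c<N λ k k<N k≢c →
                                                     h≗0 (suc k) (s<s k<N) (k≢c ∘ suc-injective)) ⟩
  h (suc c)                         ∎

∑-upTo-pick : (g : ℕ → ℕ) {N c : ℕ} → c < N → ∑[ x ∈ upTo N ] (𝟙 (x ≟ c) * g x) ≡ g c
∑-upTo-pick g {N} {c} c<N = begin
  ∑[ x ∈ upTo N ] (𝟙 (x ≟ c) * g x)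
    ≡⟨ ∑-upTo-single N c c<N (λ x _ x≢c → cong (_* g x) (𝟙-no x≢c (x ≟ c))) ⟩
  𝟙 (c ≟ c) * g c
    ≡⟨ cong (_* g c) (𝟙-yes refl (c ≟ c)) ⟩
  1 * g c
    ≡⟨ *-identityˡ (g c) ⟩
  g c
    ∎

module Multiplicity {A : Set} (_≟_ : DecidableEquality A) where

  count : A → List A → ℕ
  count x xs = ∑[ y ∈ xs ] 𝟙 (y ≟ x)

  count-↭ : ∀ x {xs ys} → xs ↭ ys → count x xs ≡ count x ys
  count-↭ x = ∑-↭ (λ y → 𝟙 (y ≟ x))

  count-∷-self : ∀ x xs → count x (x ∷ xs) ≡ suc (count x xs)
  count-∷-self x xs = cong (_+ count x xs) (𝟙-yes refl (x ≟ x))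

  count-twice-self : ∀ x → count x (x ∷ x ∷ []) ≡ 2
  count-twice-self x = cong₂ (λ u v → u + (v + 0)) (𝟙-yes refl (x ≟ x)) (𝟙-yes refl (x ≟ x))

  count-twice-≢ : ∀ {x y} → x ≢ y → count y (x ∷ x ∷ []) ≡ 0
  count-twice-≢ {x} {y} x≢y = cong₂ (λ u v → u + (v + 0)) (𝟙-no x≢y (x ≟ y)) (𝟙-no x≢y (x ≟ y))

  count>0⇒∈ : ∀ {x} xs → 0 < count x xs → x ∈ xs
  count>0⇒∈ {x} (y ∷ ys) pos with y ≟ x
  ... | yes refl = here refl
  ... | no _     = there (count>0⇒∈ ys pos)

  count-≗⇒↭ : ∀ xs ys → (∀ z → count z xs ≡ count z ys) → xs ↭ ys
  count-≗⇒↭ []       []       _     = ↭-refl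
  count-≗⇒↭ []       (y ∷ ys) xs≗ys = contradiction (trans (xs≗ys y) (count-∷-self y ys)) 0≢1+n
  count-≗⇒↭ (x ∷ xs) ys       xs≗ys
    with us , vs , refl ← ∈-∃++ (count>0⇒∈ ys (subst (0 <_) (trans (sym (count-∷-self x xs)) (xs≗ys x)) z<s)) =
    ↭-trans (↭-prep x (count-≗⇒↭ xs (us ++ vs) xs≗us++vs)) (↭-sym (shift x us vs))
    where
    xs≗us++vs : ∀ z → count z xs ≡ count z (us ++ vs)
    xs≗us++vs z = +-cancelˡ-≡ (𝟙 (x ≟ z)) _ _ (trans (xs≗ys z) (count-↭ z (shift x us vs)))

_≟₂_ : DecidableEquality (ℕ × ℕ)
_≟₂_ = ≡-dec _≟_ _≟_

open Multiplicity _≟_ using (count; count-↭; count-twice-self; count-twice-≢)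
open Multiplicity _≟₂_ using (count-≗⇒↭)
  renaming (count to count₂; count-twice-self to count₂-twice-self; count-twice-≢ to count₂-twice-≢)

count-doubled : ∀ {n d} → 0 < d → d ≤ n → count d (doubled n) ≡ 2
count-doubled {n} {suc c} _ c<n = begin
  count (suc c) (doubled n)
    ≡⟨ ∑-concatMap (λ y → 𝟙 (y ≟ suc c)) (λ t → suc t ∷ suc t ∷ []) (upTo n) ⟩
  ∑[ t ∈ upTo n ] count (suc c) (suc t ∷ suc t ∷ [])
    ≡⟨ ∑-upTo-single n c c<n (λ t _ t≢c → count-twice-≢ (t≢c ∘ suc-injective)) ⟩
  count (suc c) (suc c ∷ suc c ∷ [])
    ≡⟨ count-twice-self (suc c) ⟩
  2
    ∎

∈-doubled⇒≢0 : ∀ {n d} → d ∈ doubled n → d ≢ 0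
∈-doubled⇒≢0 {n} d∈ with satisfied (∈-concatMap⁻ (λ t → suc t ∷ suc t ∷ []) {xs = upTo n} d∈)
... | _ , here refl         = λ ()
... | _ , there (here refl) = λ ()

uedge-≤ : ∀ {x y} → x ≤ y → uedge x y ≡ (x , y)
uedge-≤ x≤y = cong₂ _,_ (m≤n⇒m⊓n≡m x≤y) (m≤n⇒m⊔n≡n x≤y)

uedge-≥ : ∀ {x y} → y ≤ x → uedge x y ≡ (y , x)
uedge-≥ y≤x = cong₂ _,_ (m≥n⇒m⊓n≡n y≤x) (m≥n⇒m⊔n≡m y≤x)

uedge≡⇔ : ∀ {i j} x y → i ≤ j → uedge x y ≡ (i , j) ⇔ (x ≡ i × y ≡ j ⊎ x ≡ j × y ≡ i)
uedge≡⇔ {i} {j} x y i≤j = mk⇔ to from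
  where
  to : uedge x y ≡ (i , j) → x ≡ i × y ≡ j ⊎ x ≡ j × y ≡ i
  to e with ≤-total x y
  ... | inj₁ x≤y with refl ← trans (sym (uedge-≤ x≤y)) e = inj₁ (refl , refl)
  ... | inj₂ y≤x with refl ← trans (sym (uedge-≥ y≤x)) e = inj₂ (refl , refl)
  from : x ≡ i × y ≡ j ⊎ x ≡ j × y ≡ i → uedge x y ≡ (i , j)
  from (inj₁ (refl , refl)) = uedge-≤ i≤j
  from (inj₂ (refl , refl)) = uedge-≥ i≤j

𝟙-uedge : ∀ {i j} x y → i < j →
          𝟙 (uedge x y ≟₂ (i , j)) ≡ 𝟙 (x ≟ i) * 𝟙 (y ≟ j) + 𝟙 (x ≟ j) * 𝟙 (y ≟ i)
𝟙-uedge {i} {j} x y i<j = begin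
  𝟙 (uedge x y ≟₂ (i , j))
    ≡⟨ 𝟙-cong (uedge≡⇔ x y (<⇒≤ i<j)) (uedge x y ≟₂ (i , j)) (ij? ⊎-dec ji?) ⟩
  𝟙 (ij? ⊎-dec ji?)
    ≡⟨ 𝟙-⊎ (λ ((x≡i , _) , (x≡j , _)) → <⇒≢ i<j (trans (sym x≡i) x≡j)) ij? ji? ⟩
  𝟙 ij? + 𝟙 ji?
    ≡⟨ cong₂ _+_ (𝟙-× (x ≟ i) (y ≟ j)) (𝟙-× (x ≟ j) (y ≟ i)) ⟩
  𝟙 (x ≟ i) * 𝟙 (y ≟ j) + 𝟙 (x ≟ j) * 𝟙 (y ≟ i)
    ∎
  where
  ij? = x ≟ i ×-dec y ≟ j
  ji? = x ≟ j ×-dec y ≟ i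

uedge-bounds : ∀ {N i j} x y → x < N → y < N → x ≢ y → uedge x y ≡ (i , j) → i < j × j < N
uedge-bounds x y x<N y<N x≢y e with ≤-total x y
... | inj₁ x≤y with refl ← trans (sym e) (uedge-≤ x≤y) = ≤∧≢⇒< x≤y x≢y , y<N
... | inj₂ y≤x with refl ← trans (sym e) (uedge-≥ y≤x) = ≤∧≢⇒< y≤x (x≢y ∘ sym) , x<N

module _ (N : ℕ) where

  private
    block : ℕ → ℕ → List (ℕ × ℕ)
    block a b = if a <ᵇ b then (a , b) ∷ (a , b) ∷ [] else []

    count₂-block-≢ : ∀ {a b} p → ¬ (a < b × (a , b) ≡ p) → count₂ p (block a b) ≡ 0
    count₂-block-≢ {a} {b} p ≢p with a <ᵇ b | <ᵇ-reflects-< a b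
    ... | false | _       = refl
    ... | true  | ofʸ a<b = count₂-twice-≢ (λ ab≡p → ≢p (a<b , ab≡p))

    count₂-block : ∀ {a b} → a < b → count₂ (a , b) (block a b) ≡ 2
    count₂-block {a} {b} a<b with a <ᵇ b | <ᵇ-reflects-< a b
    ... | false | ofⁿ a≮b = contradiction a<b a≮b
    ... | true  | _       = count₂-twice-self (a , b)

    count₂-K2 : ∀ p → count₂ p (K2 N) ≡ ∑[ a ∈ upTo N ] ∑[ b ∈ upTo N ] count₂ p (block a b)
    count₂-K2 p = trans (∑-concatMap (λ q → 𝟙 (q ≟₂ p)) (λ a → concatMap (block a) (upTo N)) (upTo N))
                        (∑-cong (upTo N) (λ a _ → ∑-concatMap (λ q → 𝟙 (q ≟₂ p)) (block a) (upTo N)))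

  K2-edge : ∀ {i j} → i < j → j < N → count₂ (i , j) (K2 N) ≡ 2
  K2-edge {i} {j} i<j j<N = begin
    count₂ (i , j) (K2 N)
      ≡⟨ count₂-K2 (i , j) ⟩
    ∑[ a ∈ upTo N ] ∑[ b ∈ upTo N ] count₂ (i , j) (block a b)
      ≡⟨ ∑-upTo-single N i (<-trans i<j j<N) (λ a _ a≢i → ∑-zero (upTo N) λ b _ →
           count₂-block-≢ {a} {b} (i , j) (a≢i ∘ cong proj₁ ∘ proj₂)) ⟩
    ∑[ b ∈ upTo N ] count₂ (i , j) (block i b)
      ≡⟨ ∑-upTo-single N j j<N (λ b _ b≢j → count₂-block-≢ {i} {b} (i , j) (b≢j ∘ cong proj₂ ∘ proj₂)) ⟩
    count₂ (i , j) (block i j)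
      ≡⟨ count₂-block i<j ⟩
    2
      ∎

  K2-nonedge : ∀ {i j} → ¬ (i < j × j < N) → count₂ (i , j) (K2 N) ≡ 0
  K2-nonedge {i} {j} nonedge = trans (count₂-K2 (i , j)) (∑-zero (upTo N) λ a _ → ∑-zero (upTo N) λ b b∈ →
    count₂-block-≢ {a} {b} (i , j) λ { (a<b , refl) → nonedge (a<b , ∈-upTo⁻ b∈) })

[m%d+n]%d≡[m+n]%d : ∀ m n d .{{_ : NonZero d}} → (m % d + n) % d ≡ (m + n) % d
[m%d+n]%d≡[m+n]%d m n d = begin
  (m % d + n) % d            ≡⟨ %-distribˡ-+ (m % d) n d ⟩
  (m % d % d + n % d) % d    ≡⟨ cong (λ r → (r + n % d) % d) (m%n%n≡m%n m d) ⟩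
  (m % d + n % d) % d        ≡⟨ %-distribˡ-+ m n d ⟨
  (m + n) % d                ∎

[m+n%d]%d≡[m+n]%d : ∀ m n d .{{_ : NonZero d}} → (m + n % d) % d ≡ (m + n) % d
[m+n%d]%d≡[m+n]%d m n d = begin
  (m + n % d) % d            ≡⟨ cong (_% d) (+-comm m (n % d)) ⟩
  (n % d + m) % d            ≡⟨ [m%d+n]%d≡[m+n]%d n m d ⟩
  (n + m) % d                ≡⟨ cong (_% d) (+-comm n m) ⟩
  (m + n) % d                ∎

x+[y+[n∸x]]≡y+n : ∀ {x n} y → x ≤ n → x + (y + (n ∸ x)) ≡ y + n
x+[y+[n∸x]]≡y+n {x} {n} y x≤n =
  trans (x∙yz≈y∙xz +-commutativeSemigroup x y (n ∸ x)) (cong (y +_) (m+[n∸m]≡n x≤n))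

module CircularDistance (N : ℕ) where

  -- dc N a b unfolds to dc₀ ∣ a - b ∣, as ∣ 0 - x ∣ reduces to x.
  dc₀ : ℕ → ℕ
  dc₀ x = dc N 0 x

  dc-self : ∀ a → dc N a a ≡ 0
  dc-self a rewrite ∣n-n∣≡0 a = refl

  dc₀-cases : ∀ x → (2 * x ≤ N × dc₀ x ≡ x) ⊎ (N < 2 * x × dc₀ x ≡ N ∸ x)
  dc₀-cases x with 2 * x ≤ᵇ N | ≤ᵇ-reflects-≤ (2 * x) N
  ... | true  | ofʸ 2x≤N = inj₁ (2x≤N , refl)
  ... | false | ofⁿ 2x≰N = inj₂ (≰⇒> 2x≰N , refl)

  private
    both-halves : ∀ {a b c} → a ≤ c → b ≤ c → a + b ≡ c + c → a ≡ c
    both-halves a≤c b≤c a+b≡c+c with m≤n⇒m<n∨m≡n a≤c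
    ... | inj₂ a≡c = a≡c
    ... | inj₁ a<c = contradiction a+b≡c+c (<⇒≢ (+-mono-<-≤ a<c b≤c))

    2x+2[N∸x]≡N+N : ∀ {x} → x ≤ N → 2 * x + 2 * (N ∸ x) ≡ N + N
    2x+2[N∸x]≡N+N {x} x≤N = begin
      2 * x + 2 * (N ∸ x)   ≡⟨ *-distribˡ-+ 2 x (N ∸ x) ⟨
      2 * (x + (N ∸ x))     ≡⟨ cong (2 *_) (m+[n∸m]≡n x≤N) ⟩
      2 * N                 ≡⟨ cong (N +_) (+-identityʳ N) ⟩
      N + N                 ∎

  dc₀-reflect : ∀ {x} → x ≤ N → dc₀ (N ∸ x) ≡ dc₀ x
  dc₀-reflect {x} x≤N with dc₀-cases x | dc₀-cases (N ∸ x)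
  ... | inj₁ (2x≤N , e₁) | inj₁ (2y≤N , e₂) = trans e₂ (trans N∸x≡x (sym e₁))
    where
    N∸x≡x : N ∸ x ≡ x
    N∸x≡x = begin
      N ∸ x            ≡⟨ cong (_∸ x) (both-halves 2x≤N 2y≤N (2x+2[N∸x]≡N+N x≤N)) ⟨
      2 * x ∸ x        ≡⟨ m+n∸m≡n x (x + 0) ⟩
      x + 0            ≡⟨ +-identityʳ x ⟩
      x                ∎
  ... | inj₁ (_ , e₁)    | inj₂ (_ , e₂)    = trans e₂ (trans (m∸[m∸n]≡n x≤N) (sym e₁))
  ... | inj₂ (_ , e₁)    | inj₁ (_ , e₂)    = trans e₂ (sym e₁)
  ... | inj₂ (N<2x , _)  | inj₂ (N<2y , _)  =
    contradiction (2x+2[N∸x]≡N+N x≤N) (≢-sym (<⇒≢ (+-mono-< N<2x N<2y)))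

  dc₀≡dc₀⇔ : ∀ {x y} → x ≤ N → y ≤ N → dc₀ x ≡ dc₀ y ⇔ (x ≡ y ⊎ x + y ≡ N)
  dc₀≡dc₀⇔ {x} {y} x≤N y≤N = mk⇔ to from
    where
    to : dc₀ x ≡ dc₀ y → x ≡ y ⊎ x + y ≡ N
    to e with dc₀-cases x | dc₀-cases y
    ... | inj₁ (_ , e₁) | inj₁ (_ , e₂) = inj₁ (trans (sym e₁) (trans e e₂))
    ... | inj₁ (_ , e₁) | inj₂ (_ , e₂) =
      inj₂ (trans (cong (_+ y) (trans (sym e₁) (trans e e₂))) (m∸n+n≡m y≤N))
    ... | inj₂ (_ , e₁) | inj₁ (_ , e₂) =
      inj₂ (trans (cong (x +_) (trans (sym e₂) (trans (sym e) e₁))) (m+[n∸m]≡n x≤N))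
    ... | inj₂ (_ , e₁) | inj₂ (_ , e₂) = inj₁ (∸-cancelˡ-≡ x≤N y≤N (trans (sym e₁) (trans e e₂)))
    from : x ≡ y ⊎ x + y ≡ N → dc₀ x ≡ dc₀ y
    from (inj₁ x≡y)   = cong dc₀ x≡y
    from (inj₂ x+y≡N) = trans (cong dc₀ (trans (sym (m+n∸n≡m x y)) (cong (_∸ y) x+y≡N))) (dc₀-reflect y≤N)

module Cyclic (N : ℕ) .{{_ : NonZero N}} where

  open CircularDistance N

  δ : ℕ → ℕ → ℕ
  δ a b = (b + (N ∸ a)) % N

  δ<N : ∀ a b → δ a b < N
  δ<N a b = m%n<n (b + (N ∸ a)) N

  [i+d]%N≡j⇔d≡δij : ∀ {i j d} → i ≤ N → j < N → d < N → (i + d) % N ≡ j ⇔ d ≡ δ i j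
  [i+d]%N≡j⇔d≡δij {i} {j} {d} i≤N j<N d<N = mk⇔ to from
    where
    to : (i + d) % N ≡ j → d ≡ δ i j
    to e = begin
      d                              ≡⟨ m<n⇒m%n≡m d<N ⟨
      d % N                          ≡⟨ [m+n]%n≡m%n d N ⟨
      (d + N) % N                    ≡⟨ cong (_% N) (x+[y+[n∸x]]≡y+n d i≤N) ⟨
      (i + (d + (N ∸ i))) % N        ≡⟨ cong (_% N) (+-assoc i d (N ∸ i)) ⟨
      (i + d + (N ∸ i)) % N          ≡⟨ [m%d+n]%d≡[m+n]%d (i + d) (N ∸ i) N ⟨
      ((i + d) % N + (N ∸ i)) % N    ≡⟨ cong (λ r → (r + (N ∸ i)) % N) e ⟩
      δ i j                          ∎
    from : d ≡ δ i j → (i + d) % N ≡ j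
    from refl = begin
      (i + δ i j) % N                ≡⟨ [m+n%d]%d≡[m+n]%d i (j + (N ∸ i)) N ⟩
      (i + (j + (N ∸ i))) % N        ≡⟨ cong (_% N) (x+[y+[n∸x]]≡y+n j i≤N) ⟩
      (j + N) % N                    ≡⟨ [m+n]%n≡m%n j N ⟩
      j % N                          ≡⟨ m<n⇒m%n≡m j<N ⟩
      j                              ∎

  δ-self : ∀ {x} → x ≤ N → δ x x ≡ 0
  δ-self x≤N = trans (cong (_% N) (m+[n∸m]≡n x≤N)) (n%n≡0 N)

  δ≢0 : ∀ {a b} → a < N → b < N → a ≢ b → δ a b ≢ 0
  δ≢0 {a} {b} a<N b<N a≢b δab≡0 = a≢b (begin
    a                 ≡⟨ m<n⇒m%n≡m a<N ⟨
    a % N             ≡⟨ cong (_% N) (+-identityʳ a) ⟨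
    (a + 0) % N       ≡⟨ cong (λ d → (a + d) % N) δab≡0 ⟨
    (a + δ a b) % N   ≡⟨ Equivalence.from ([i+d]%N≡j⇔d≡δij (<⇒≤ a<N) b<N (δ<N a b)) refl ⟩
    b                 ∎)

  δ-≤ : ∀ {a b} → a ≤ b → b < N → δ a b ≡ b ∸ a
  δ-≤ {a} {b} a≤b b<N = begin
    (b + (N ∸ a)) % N               ≡⟨ cong (λ r → (r + (N ∸ a)) % N) (m∸n+n≡m a≤b) ⟨
    (b ∸ a + a + (N ∸ a)) % N       ≡⟨ cong (_% N) (+-assoc (b ∸ a) a (N ∸ a)) ⟩
    (b ∸ a + (a + (N ∸ a))) % N     ≡⟨ cong (λ r → (b ∸ a + r) % N) (m+[n∸m]≡n (<⇒≤ (≤-<-trans a≤b b<N))) ⟩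
    (b ∸ a + N) % N                 ≡⟨ [m+n]%n≡m%n (b ∸ a) N ⟩
    (b ∸ a) % N                     ≡⟨ m<n⇒m%n≡m (≤-<-trans (m∸n≤m b a) b<N) ⟩
    b ∸ a                           ∎

  δ-> : ∀ {a b} → b < a → a < N → δ a b ≡ N ∸ (a ∸ b)
  δ-> {a} {b} b<a a<N = begin
    (b + (N ∸ a)) % N                      ≡⟨ m<n⇒m%n≡m b+[N∸a]<N ⟩
    b + (N ∸ a)                            ≡⟨ m+n∸m≡n (a ∸ b) (b + (N ∸ a)) ⟨
    a ∸ b + (b + (N ∸ a)) ∸ (a ∸ b)        ≡⟨ cong (_∸ (a ∸ b)) split ⟩
    N ∸ (a ∸ b)                            ∎
    where
    split : a ∸ b + (b + (N ∸ a)) ≡ N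
    split = trans (sym (+-assoc (a ∸ b) b (N ∸ a)))
                  (trans (cong (_+ (N ∸ a)) (m∸n+n≡m (<⇒≤ b<a))) (m+[n∸m]≡n (<⇒≤ a<N)))
    b+[N∸a]<N : b + (N ∸ a) < N
    b+[N∸a]<N = subst (b + (N ∸ a) <_) split (m<n+m (b + (N ∸ a)) (m<n⇒0<n∸m b<a))

  δ+δ≡N : ∀ {i j} → i < N → j < N → i ≢ j → δ i j + δ j i ≡ N
  δ+δ≡N {i} {j} i<N j<N i≢j with <-cmp i j
  ... | tri< i<j _ _ = trans (cong₂ _+_ (δ-≤ (<⇒≤ i<j) j<N) (δ-> i<j j<N))
                             (m+[n∸m]≡n (≤-trans (m∸n≤m j i) (<⇒≤ j<N)))
  ... | tri≈ _ i≡j _ = contradiction i≡j i≢j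
  ... | tri> _ _ j<i = trans (cong₂ _+_ (δ-> j<i i<N) (δ-≤ (<⇒≤ j<i) i<N))
                             (m∸n+n≡m (≤-trans (m∸n≤m i j) (<⇒≤ i<N)))

  dc≡dc₀∘δ : ∀ {a b} → a < N → b < N → dc N a b ≡ dc₀ (δ a b)
  dc≡dc₀∘δ {a} {b} a<N b<N with <-cmp a b
  ... | tri< a<b _ _ = cong dc₀ (trans (m≤n⇒∣m-n∣≡n∸m (<⇒≤ a<b)) (sym (δ-≤ (<⇒≤ a<b) b<N)))
  ... | tri≈ _ refl _ = cong dc₀ (trans (∣n-n∣≡0 a) (sym (δ-self (<⇒≤ a<N))))
  ... | tri> _ _ b<a = begin
    dc₀ ∣ a - b ∣        ≡⟨ cong dc₀ (m≤n⇒∣n-m∣≡n∸m (<⇒≤ b<a)) ⟩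
    dc₀ (a ∸ b)          ≡⟨ dc₀-reflect (≤-trans (m∸n≤m a b) (<⇒≤ a<N)) ⟨
    dc₀ (N ∸ (a ∸ b))    ≡⟨ cong dc₀ (δ-> b<a a<N) ⟨
    dc₀ (δ a b)          ∎

  δ-rotate : ∀ a b k → a ≤ N → ((a + k) % N + δ a b) % N ≡ (b + k) % N
  δ-rotate a b k a≤N = begin
    ((a + k) % N + δ a b) % N       ≡⟨ [m%d+n]%d≡[m+n]%d (a + k) (δ a b) N ⟩
    (a + k + δ a b) % N             ≡⟨ [m+n%d]%d≡[m+n]%d (a + k) (b + (N ∸ a)) N ⟩
    (a + k + (b + (N ∸ a))) % N     ≡⟨ cong (_% N) (+-assoc a k (b + (N ∸ a))) ⟩
    (a + (k + (b + (N ∸ a)))) % N   ≡⟨ cong (λ r → (a + r) % N) (+-assoc k b (N ∸ a)) ⟨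
    (a + (k + b + (N ∸ a))) % N     ≡⟨ cong (_% N) (x+[y+[n∸x]]≡y+n (k + b) a≤N) ⟩
    (k + b + N) % N                 ≡⟨ [m+n]%n≡m%n (k + b) N ⟩
    (k + b) % N                     ≡⟨ cong (_% N) (+-comm k b) ⟩
    (b + k) % N                     ∎

  ∑-upTo-rotate : (h : ℕ → ℕ) {a : ℕ} → a ≤ N → ∑[ k ∈ upTo N ] h ((a + k) % N) ≡ ∑ (upTo N) h
  ∑-upTo-rotate h {a} a≤N = begin
    ∑[ k ∈ upTo N ] h ((a + k) % N)                  ≡⟨ cong (λ M → ∑[ k ∈ upTo M ] h ((a + k) % N)) m+a≡N ⟨
    ∑[ k ∈ upTo (m + a) ] h ((a + k) % N)            ≡⟨ ∑-upTo-+ (λ k → h ((a + k) % N)) m a ⟩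
    ∑[ k ∈ upTo m ] h ((a + k) % N) + ∑[ k ∈ upTo a ] h ((a + (m + k)) % N)
                                                     ≡⟨ cong₂ _+_ (∑-upTo-cong m (λ k → cong h ∘ m<n⇒m%n≡m ∘ a+k<N))
                                                                  (∑-upTo-cong a (λ k → cong h ∘ wraps)) ⟩
    ∑[ k ∈ upTo m ] h (a + k) + ∑ (upTo a) h         ≡⟨ +-comm _ (∑ (upTo a) h) ⟩
    ∑ (upTo a) h + ∑[ k ∈ upTo m ] h (a + k)         ≡⟨ ∑-upTo-+ h a m ⟨
    ∑ (upTo (a + m)) h                               ≡⟨ cong (λ M → ∑ (upTo M) h) a+m≡N ⟩
    ∑ (upTo N) h                                     ∎
    where
    m = N ∸ a
    m+a≡N : m + a ≡ N
    m+a≡N = m∸n+n≡m a≤N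
    a+m≡N : a + m ≡ N
    a+m≡N = m+[n∸m]≡n a≤N
    a+k<N : ∀ {k} → k < m → a + k < N
    a+k<N k<m = subst (_ <_) a+m≡N (+-monoʳ-< a k<m)
    wraps : ∀ {k} → k < a → (a + (m + k)) % N ≡ k
    wraps {k} k<a = begin
      (a + (m + k)) % N   ≡⟨ cong (_% N) (+-assoc a m k) ⟨
      (a + m + k) % N     ≡⟨ cong (λ M → (M + k) % N) a+m≡N ⟩
      (N + k) % N         ≡⟨ cong (_% N) (+-comm N k) ⟩
      (k + N) % N         ≡⟨ [m+n]%n≡m%n k N ⟩
      k % N               ≡⟨ m<n⇒m%n≡m (<-≤-trans k<a a≤N) ⟩
      k                   ∎

  orbitCount : ℕ → ℕ → ℕ × ℕ → ℕ
  orbitCount a b p = ∑[ k ∈ upTo N ] 𝟙 (uedge ((a + k) % N) ((b + k) % N) ≟₂ p)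

  chordCount : ℕ → ℕ × ℕ → ℕ
  chordCount d p = ∑[ x ∈ upTo N ] 𝟙 (uedge x ((x + d) % N) ≟₂ p)

  orbitCount≡chordCount : ∀ {a} b p → a ≤ N → orbitCount a b p ≡ chordCount (δ a b) p
  orbitCount≡chordCount {a} b p a≤N = begin
    ∑[ k ∈ upTo N ] 𝟙 (uedge ((a + k) % N) ((b + k) % N) ≟₂ p)
      ≡⟨ ∑-cong (upTo N) (λ k _ → cong (λ y → 𝟙 (uedge ((a + k) % N) y ≟₂ p)) (δ-rotate a b k a≤N)) ⟨
    ∑[ k ∈ upTo N ] 𝟙 (uedge ((a + k) % N) (((a + k) % N + δ a b) % N) ≟₂ p)
      ≡⟨ ∑-upTo-rotate (λ x → 𝟙 (uedge x ((x + δ a b) % N) ≟₂ p)) a≤N ⟩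
    chordCount (δ a b) p
      ∎

  chordCount-edge : ∀ {i j d} → i < j → j < N → d < N →
                    chordCount d (i , j) ≡ 𝟙 (d ≟ δ i j) + 𝟙 (d ≟ δ j i)
  chordCount-edge {i} {j} {d} i<j j<N d<N = begin
    chordCount d (i , j)
      ≡⟨ ∑-cong (upTo N) (λ x _ → 𝟙-uedge x (y x) i<j) ⟩
    ∑[ x ∈ upTo N ] (𝟙 (x ≟ i) * 𝟙 (y x ≟ j) + 𝟙 (x ≟ j) * 𝟙 (y x ≟ i))
      ≡⟨ ∑-+ (λ x → 𝟙 (x ≟ i) * 𝟙 (y x ≟ j)) (λ x → 𝟙 (x ≟ j) * 𝟙 (y x ≟ i)) (upTo N) ⟩
    ∑[ x ∈ upTo N ] (𝟙 (x ≟ i) * 𝟙 (y x ≟ j)) + ∑[ x ∈ upTo N ] (𝟙 (x ≟ j) * 𝟙 (y x ≟ i))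
      ≡⟨ cong₂ _+_ (∑-upTo-pick (λ x → 𝟙 (y x ≟ j)) i<N) (∑-upTo-pick (λ x → 𝟙 (y x ≟ i)) j<N) ⟩
    𝟙 (y i ≟ j) + 𝟙 (y j ≟ i)
      ≡⟨ cong₂ _+_ (𝟙-cong ([i+d]%N≡j⇔d≡δij (<⇒≤ i<N) j<N d<N) (y i ≟ j) (d ≟ δ i j))
                   (𝟙-cong ([i+d]%N≡j⇔d≡δij (<⇒≤ j<N) i<N d<N) (y j ≟ i) (d ≟ δ j i)) ⟩
    𝟙 (d ≟ δ i j) + 𝟙 (d ≟ δ j i)
      ∎
    where
    y : ℕ → ℕ
    y x = (x + d) % N
    i<N : i < N
    i<N = <-trans i<j j<N

  chordCount-nonedge : ∀ {i j d} → 0 < d → d < N → ¬ (i < j × j < N) → chordCount d (i , j) ≡ 0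
  chordCount-nonedge {i} {j} {d} 0<d d<N nonedge = ∑-zero (upTo N) λ x x∈ →
    𝟙-no (nonedge ∘ uedge-bounds x _ (∈-upTo⁻ x∈) (m%n<n (x + d) N) (x≢x+d (∈-upTo⁻ x∈)))
         (uedge x ((x + d) % N) ≟₂ (i , j))
    where
    x≢x+d : ∀ {x} → x < N → x ≢ (x + d) % N
    x≢x+d x<N x≡x+d = >⇒≢ 0<d (trans (Equivalence.to ([i+d]%N≡j⇔d≡δij (<⇒≤ x<N) x<N d<N) (sym x≡x+d))
                                      (δ-self (<⇒≤ x<N)))

  orbitCount-nonedge : ∀ {a b i j} → a < N → b < N → a ≢ b → ¬ (i < j × j < N) →
                       orbitCount a b (i , j) ≡ 0
  orbitCount-nonedge {a} {b} a<N b<N a≢b nonedge =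
    trans (orbitCount≡chordCount b _ (<⇒≤ a<N))
          (chordCount-nonedge (n≢0⇒n>0 (δ≢0 a<N b<N a≢b)) (δ<N a b) nonedge)

  count₂-cyclicUnion : ∀ p (E : Edges N) (f : Fin N → Fin N) →
    count₂ p (cyclicUnion E f) ≡ ∑[ e ∈ E ] orbitCount (toℕ (f (proj₁ e))) (toℕ (f (proj₂ e))) p
  count₂-cyclicUnion p E f = begin
    count₂ p (concatMap (λ k → copyEdges E (rot k f)) (upTo N))
      ≡⟨ ∑-concatMap (λ q → 𝟙 (q ≟₂ p)) (λ k → copyEdges E (rot k f)) (upTo N) ⟩
    ∑[ k ∈ upTo N ] count₂ p (copyEdges E (rot k f))
      ≡⟨ ∑-cong (upTo N) (λ k _ → ∑-map (λ q → 𝟙 (q ≟₂ p)) _ E) ⟩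
    ∑[ k ∈ upTo N ] ∑[ e ∈ E ] 𝟙 (uedge (rot k f (proj₁ e)) (rot k f (proj₂ e)) ≟₂ p)
      ≡⟨ ∑-swap (λ k e → 𝟙 (uedge (rot k f (proj₁ e)) (rot k f (proj₂ e)) ≟₂ p)) (upTo N) E ⟩
    ∑[ e ∈ E ] orbitCount (toℕ (f (proj₁ e))) (toℕ (f (proj₂ e))) p
      ∎

module OddCyclic (n : ℕ) where

  N : ℕ
  N = suc (2 * n)

  open CircularDistance N public
  open Cyclic N public

  dc₀-bounds : ∀ {x} → 0 < x → x < N → 0 < dc₀ x × dc₀ x ≤ n
  dc₀-bounds {x} 0<x x<N with dc₀-cases x
  ... | inj₁ (2x≤N , e) rewrite e =
    0<x , s≤s⁻¹ (*-cancelˡ-< 2 x (suc n) (subst (2 * x <_) (sym (*-suc 2 n)) (s≤s 2x≤N)))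
  ... | inj₂ (N<2x , e) rewrite e =
    m<n⇒0<n∸m x<N , ≤-trans (∸-monoʳ-≤ N n<x) (≤-reflexive N∸[1+n]≡n)
    where
    n<x : n < x
    n<x = *-cancelˡ-< 2 n x (<-trans (n<1+n (2 * n)) N<2x)
    N∸[1+n]≡n : N ∸ suc n ≡ n
    N∸[1+n]≡n = trans (m+n∸m≡n n (n + 0)) (+-identityʳ n)

  dc-bounds : ∀ {i j} → i < j → j < N → 0 < dc N i j × dc N i j ≤ n
  dc-bounds {i} {j} i<j j<N = subst (λ x → 0 < dc₀ x × dc₀ x ≤ n) (sym (m≤n⇒∣m-n∣≡n∸m (<⇒≤ i<j)))
                                    (dc₀-bounds (m<n⇒0<n∸m i<j) (≤-<-trans (m∸n≤m j i) j<N))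

  𝟙-δ+𝟙-δ≡𝟙-dc₀ : ∀ {i j d} → i < N → j < N → i ≢ j → d ≤ N →
                   𝟙 (d ≟ δ i j) + 𝟙 (d ≟ δ j i) ≡ 𝟙 (dc₀ d ≟ dc₀ (δ i j))
  𝟙-δ+𝟙-δ≡𝟙-dc₀ {i} {j} {d} i<N j<N i≢j d≤N = begin
    𝟙 (d ≟ δ i j) + 𝟙 (d ≟ δ j i)
      ≡⟨ 𝟙-⊎ exclusive (d ≟ δ i j) (d ≟ δ j i) ⟨
    𝟙 (d ≟ δ i j ⊎-dec d ≟ δ j i)
      ≡⟨ 𝟙-cong (mk⇔ to from) (d ≟ δ i j ⊎-dec d ≟ δ j i) (dc₀ d ≟ dc₀ (δ i j)) ⟩
    𝟙 (dc₀ d ≟ dc₀ (δ i j))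
      ∎
    where
    δji+δij≡N : δ j i + δ i j ≡ N
    δji+δij≡N = trans (+-comm (δ j i) (δ i j)) (δ+δ≡N i<N j<N i≢j)
    exclusive : ¬ (d ≡ δ i j × d ≡ δ j i)
    exclusive (refl , δij≡δji) = even≢odd (δ i j) n (begin
      2 * δ i j       ≡⟨ cong (δ i j +_) (+-identityʳ (δ i j)) ⟩
      δ i j + δ i j   ≡⟨ cong (δ i j +_) δij≡δji ⟩
      δ i j + δ j i   ≡⟨ δ+δ≡N i<N j<N i≢j ⟩
      N               ∎)
    dc₀⇔ : dc₀ d ≡ dc₀ (δ i j) ⇔ (d ≡ δ i j ⊎ d + δ i j ≡ N)
    dc₀⇔ = dc₀≡dc₀⇔ d≤N (<⇒≤ (δ<N i j))
    to : d ≡ δ i j ⊎ d ≡ δ j i → dc₀ d ≡ dc₀ (δ i j)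
    to = Equivalence.from dc₀⇔ ∘ Sum.map₂ (λ d≡δji → trans (cong (_+ δ i j) d≡δji) δji+δij≡N)
    from : dc₀ d ≡ dc₀ (δ i j) → d ≡ δ i j ⊎ d ≡ δ j i
    from = Sum.map₂ (λ d+δij≡N → +-cancelʳ-≡ (δ i j) d (δ j i) (trans d+δij≡N (sym δji+δij≡N)))
         ∘ Equivalence.to dc₀⇔

  orbitCount-edge : ∀ {a b i j} → a < N → b < N → i < j → j < N →
                    orbitCount a b (i , j) ≡ 𝟙 (dc N a b ≟ dc N i j)
  orbitCount-edge {a} {b} {i} {j} a<N b<N i<j j<N = begin
    orbitCount a b (i , j)
      ≡⟨ orbitCount≡chordCount b (i , j) (<⇒≤ a<N) ⟩
    chordCount (δ a b) (i , j)
      ≡⟨ chordCount-edge i<j j<N (δ<N a b) ⟩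
    𝟙 (δ a b ≟ δ i j) + 𝟙 (δ a b ≟ δ j i)
      ≡⟨ 𝟙-δ+𝟙-δ≡𝟙-dc₀ i<N j<N (<⇒≢ i<j) (<⇒≤ (δ<N a b)) ⟩
    𝟙 (dc₀ (δ a b) ≟ dc₀ (δ i j))
      ≡⟨ cong₂ (λ u v → 𝟙 (u ≟ v)) (dc≡dc₀∘δ a<N b<N) (dc≡dc₀∘δ i<N j<N) ⟨
    𝟙 (dc N a b ≟ dc N i j)
      ∎
    where
    i<N : i < N
    i<N = <-trans i<j j<N

  module Labelled (E : Edges N) (ℓ : Fin N → Fin N) where

    ℓ₁ ℓ₂ label : Fin N × Fin N → ℕ
    ℓ₁ e = toℕ (ℓ (proj₁ e))
    ℓ₂ e = toℕ (ℓ (proj₂ e))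
    label e = dc N (suc (ℓ₁ e)) (suc (ℓ₂ e))

    ℓ₁<N : ∀ e → ℓ₁ e < N
    ℓ₁<N e = toℕ<n (ℓ (proj₁ e))

    ℓ₂<N : ∀ e → ℓ₂ e < N
    ℓ₂<N e = toℕ<n (ℓ (proj₂ e))

    module _ (labels↭doubled : map label E ↭ doubled n) where

      endpoints-distinct : ∀ {e} → e ∈ E → ℓ₁ e ≢ ℓ₂ e
      endpoints-distinct {e} e∈E ℓ₁≡ℓ₂ =
        ∈-doubled⇒≢0 {n} (∈-resp-↭ labels↭doubled (∈-map⁺ label e∈E))
                         (trans (cong (dc N (ℓ₁ e)) (sym ℓ₁≡ℓ₂)) (dc-self (ℓ₁ e)))

      cyclicUnion-multiplicity : ∀ p → count₂ p (cyclicUnion E ℓ) ≡ count₂ p (K2 N)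
      cyclicUnion-multiplicity (i , j) with i <? j ×-dec j <? N
      ... | yes (i<j , j<N) = begin
        count₂ (i , j) (cyclicUnion E ℓ)
          ≡⟨ count₂-cyclicUnion (i , j) E ℓ ⟩
        ∑[ e ∈ E ] orbitCount (ℓ₁ e) (ℓ₂ e) (i , j)
          ≡⟨ ∑-cong E (λ e _ → orbitCount-edge (ℓ₁<N e) (ℓ₂<N e) i<j j<N) ⟩
        ∑[ e ∈ E ] 𝟙 (label e ≟ dc N i j)
          ≡⟨ ∑-map (λ d → 𝟙 (d ≟ dc N i j)) label E ⟨
        count (dc N i j) (map label E)
          ≡⟨ count-↭ (dc N i j) labels↭doubled ⟩
        count (dc N i j) (doubled n)
          ≡⟨ uncurry count-doubled (dc-bounds i<j j<N) ⟩
        2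
          ≡⟨ K2-edge N i<j j<N ⟨
        count₂ (i , j) (K2 N)
          ∎
      ... | no nonedge = begin
        count₂ (i , j) (cyclicUnion E ℓ)
          ≡⟨ count₂-cyclicUnion (i , j) E ℓ ⟩
        ∑[ e ∈ E ] orbitCount (ℓ₁ e) (ℓ₂ e) (i , j)
          ≡⟨ ∑-zero E (λ e e∈E → orbitCount-nonedge (ℓ₁<N e) (ℓ₂<N e) (endpoints-distinct e∈E) nonedge) ⟩
        0
          ≡⟨ K2-nonedge N nonedge ⟨
        count₂ (i , j) (K2 N)
          ∎

mainTheorem2 : (n : ℕ) (E : Edges (suc (2 * n))) →
    IsTree (suc (2 * n)) E → Semigraceful n E →
    Σ (Fin (suc (2 * n)) → Fin (suc (2 * n))) λ f0 →
      Injective _≡_ _≡_ f0 × (cyclicUnion E f0 ↭ K2 (suc (2 * n)))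
mainTheorem2 n E _ (ℓ , ℓ-bijective , labels↭doubled) =
  ℓ , proj₁ ℓ-bijective , count-≗⇒↭ _ _ (cyclicUnion-multiplicity labels↭doubled)
  where
  open OddCyclic n
  open Labelled E ℓ
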